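{- Let $\Sigma$ be an alphabet, $x,y\in\Sigma^n$, $t\ge1$, $i\in[n]$, and let $\mathcal{D}\subseteq[-t..t]$ be a set of integers with $|\mathcal{D}|>1$. Let $g=\gcd\{d-d' : d>d',\ d,d'\in\mathcal{D}\}$, $p=x_{[i-g+1..i]}$ and $m=\max\mathcal{D}-\min\mathcal{D}$, and assume all indices used below lie in $[1..n]$. Assume that $x_{[i-2m+1..i]}$ and $y_{[i-2m+1+\min\mathcal{D}..i+\max\mathcal{D}]}$ are both periodic with the same period pattern $p$, but that $x_{i+1}\neq p_1$ or $y_{i+1+\max\mathcal{D}}\neq p_1$. Then every $d\in\mathcal{D}$, except perhaps at most one, satisfies $x_j\neq y_{j+d}$ for at least one $j\in\{i+1,\dots,i+m\}$.
   Context: For a string $z$ and a set of positions $I$, $z_I$ denotes the restriction of $z$ to positions in $I$ (in natural order); $[a..b]=\{a,\dots,b\}$. A string $z\in\Sigma^N$ is periodic with period length $\ell<N$ and period pattern $p\in\Sigma^\ell$ if $z=p^{\lfloor N/\ell\rfloor}\circ q$ where $q$ is the prefix of $p$ of length $(N\bmod \ell)$, with the convention that $N\bmod\ell$ takes values in $[1..\ell]$; $\circ$ denotes concatenation. -}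

module Defs where

open import Data.Nat as ℕ using (ℕ; zero; suc; NonZero)
open import Data.Nat.DivMod using (_%_)
open import Data.Nat.GCD using (gcd)
open import Data.Integer as ℤ using (ℤ; +_; -[1+_]; _-_; ∣_∣; _⊔_; _⊓_)
open import Data.Fin using (fromℕ<)
open import Data.Vec using (Vec; lookup)
open import Data.Maybe using (Maybe; just; nothing)
open import Data.List using (List; []; _∷_; foldr; concatMap)
open import Data.Product using (_×_)
open import Data.Empty using (⊥)
open import Data.Bool using (if_then_else_)
open import Relation.Nullary using (does; yes; no)
open import Relation.Binary.PropositionalEquality using (_≡_)

-- 1-indexed access to a string x ∈ Σⁿ at an integer position j:
-- just x_j if j ∈ [1..n], nothing otherwise.
at : ∀ {A : Set} {n : ℕ} → Vec A n → ℤ → Maybe A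
at {n = n} v (+ suc k) with k ℕ.<? n
... | yes k<n = just (lookup v (fromℕ< k<n))
... | no _ = nothing
at v (+ zero) = nothing
at v -[1+ _ ] = nothing

-- A string z of length N (given 0-based: z k for k < N) is periodic with
-- period length ℓ < N and period pattern p (p r for r < ℓ), i.e.
-- z = p^⌊N/ℓ⌋ ∘ q with q the prefix of p of length (N mod ℓ);
-- written out positionwise: z k = p (k mod ℓ) for every k < N.
IsPeriodic : {B : Set} → (z : ℕ → B) → (N ℓ : ℕ) → (p : ℕ → B) → Set
IsPeriodic z N zero p = ⊥
IsPeriodic z N (suc l) p =
  (suc l ℕ.< N) × (∀ k → k ℕ.< N → z k ≡ p (k % suc l))

maxL : List ℤ → ℤ
maxL [] = + 0
maxL (d ∷ ds) = foldr _⊔_ d ds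

minL : List ℤ → ℤ
minL [] = + 0
minL (d ∷ ds) = foldr _⊓_ d ds

diffs : List ℤ → List ℕ
diffs D = concatMap (λ d → concatMap (λ d' →
  if does (d' ℤ.<? d) then ∣ d - d' ∣ ∷ [] else []) D) D

gcdDiffs : List ℤ → ℕ
gcdDiffs D = foldr gcd 0 (diffs D)

-- Write mn, mx for min D and max D, and suppose d < d' in D both have no
-- mismatch on [i+1..i+m]. Since g divides m, every position i+1+e with
-- e ∈ [mn..mx) and g ∣ e - mn sits at a multiple of g in the periodic window of
-- y, so y_{i+1+e} = p_1. If x_{i+1} ≠ p_1, the shift d mismatches already at
-- j = i+1 (take e = d). Otherwise y_{i+1+mx} ≠ p_1; put a = mx - d'. At
-- j = i+1+a the shift d' pairs x_j with y_{i+1+mx}, while the shift d pairs it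
-- with y_{i+1+a+d} = p_1, because a + d < mx and g divides a + (d - mn).
-- Neither the periodicity of x nor the index-range hypotheses are used.
module Submission where

open import Defs
open import Data.Nat as ℕ using (ℕ; suc)
open import Data.Integer as ℤ using (ℤ; +_; -_; _+_; _-_; _*_; _≤_; ∣_∣)
open import Data.Vec using (Vec)
open import Data.List using (List; length)
open import Data.List.Membership.Propositional using (_∈_)
open import Data.List.Relation.Unary.All using (All)
open import Data.List.Relation.Unary.Unique.Propositional using (Unique)
open import Data.Product using (_×_; ∃-syntax)
open import Data.Sum using (_⊎_)
open import Relation.Nullary using (¬_)
open import Relation.Binary.PropositionalEquality using (_≡_; _≢_)

import Data.Nat.Properties as ℕ
open import Data.Nat.Divisibility using (_∣_; ∣-trans; _∣0; ∣m∣n⇒∣m+n; ∣n⇒∣m*n; n∣m⇒m%n≡0)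
open import Data.Nat.GCD using (gcd; gcd[m,n]∣m; gcd[m,n]∣n)
open import Data.Integer.Properties
open import Data.Integer.Tactic.RingSolver using (solve-∀)
open import Data.List using ([]; _∷_; foldr)
open import Data.List.Properties using (foldr-preservesᵒ)
open import Data.List.Membership.Propositional using (lose)
open import Data.List.Membership.Propositional.Properties using (foldr-selective; ∈-concatMap⁺)
open import Data.List.Relation.Unary.Any using (here; there)
import Data.List.Relation.Unary.Any as Any
open import Data.Product using (_,_; ∃₂)
open import Data.Sum using (inj₁; inj₂; [_,_]; [_,_]′)
open import Data.Empty using (⊥-elim)
open import Data.Bool using (if_then_else_)
open import Relation.Nullary using (does)
open import Relation.Nullary.Decidable using (dec-true)
open import Relation.Binary using (tri<; tri≈; tri>)
open import Relation.Binary.PropositionalEquality using (refl; sym; trans; cong; cong₂; subst)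
open import Relation.Binary.PropositionalEquality.Properties using (module ≡-Reasoning)

maxL-upper : ∀ D {d} → d ∈ D → d ≤ maxL D
maxL-upper (e ∷ es) {d} d∈ = foldr-preservesᵒ ⊔-upper e es (split d∈)
  where
  ⊔-upper : ∀ u v → d ≤ u ⊎ d ≤ v → d ≤ u ℤ.⊔ v
  ⊔-upper u v = [ i≤j⇒i≤j⊔k v , i≤j⇒i≤k⊔j u ]
  split : d ∈ e ∷ es → d ≤ e ⊎ Any.Any (d ≤_) es
  split (here refl) = inj₁ ≤-refl
  split (there d∈es) = inj₂ (Any.map ≤-reflexive d∈es)

minL-lower : ∀ D {d} → d ∈ D → minL D ≤ d
minL-lower (e ∷ es) {d} d∈ = foldr-preservesᵒ ⊓-lower e es (split d∈)
  where
  ⊓-lower : ∀ u v → u ≤ d ⊎ v ≤ d → u ℤ.⊓ v ≤ d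
  ⊓-lower u v = [ i≤j⇒i⊓k≤j v , i≤j⇒k⊓i≤j u ]
  split : d ∈ e ∷ es → e ≤ d ⊎ Any.Any (_≤ d) es
  split (here refl) = inj₁ ≤-refl
  split (there d∈es) = inj₂ (Any.map (λ d≡u → ≤-reflexive (sym d≡u)) d∈es)

maxL-∈ : ∀ D {d} → d ∈ D → maxL D ∈ D
maxL-∈ (e ∷ es) _ = [ here , there ]′ (foldr-selective ⊔-sel e es)

minL-∈ : ∀ D {d} → d ∈ D → minL D ∈ D
minL-∈ (e ∷ es) _ = [ here , there ]′ (foldr-selective ⊓-sel e es)

foldr-gcd-∣ : ∀ ks {k} → k ∈ ks → foldr gcd 0 ks ∣ k
foldr-gcd-∣ (k ∷ ks) (here refl) = gcd[m,n]∣m k _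
foldr-gcd-∣ (k ∷ ks) (there k∈) = ∣-trans (gcd[m,n]∣n k _) (foldr-gcd-∣ ks k∈)

∈-diffs : ∀ D {u v} → u ∈ D → v ∈ D → v ℤ.< u → ∣ u - v ∣ ∈ diffs D
∈-diffs D {u} {v} u∈ v∈ v<u =
  ∈-concatMap⁺ _ (lose u∈ (∈-concatMap⁺ _ (lose v∈ kept)))
  where
  kept : ∣ u - v ∣ ∈ (if does (v ℤ.<? u) then ∣ u - v ∣ ∷ [] else [])
  kept rewrite dec-true (v ℤ.<? u) v<u = here refl

gcdDiffs-∣ : ∀ D {u v} → u ∈ D → v ∈ D → v ≤ u → gcdDiffs D ∣ ∣ u - v ∣
gcdDiffs-∣ D {u} {v} u∈ v∈ v≤u with <-cmp v u
... | tri< v<u _ _ = foldr-gcd-∣ (diffs D) (∈-diffs D u∈ v∈ v<u)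
... | tri≈ _ refl _ = subst (λ w → gcdDiffs D ∣ ∣ w ∣) (sym (+-inverseʳ u)) (_ ∣0)
... | tri> _ _ u<v = ⊥-elim (<-irrefl refl (<-≤-trans u<v v≤u))

i≤j⇒i+∣j-i∣≡j : ∀ {i j} → i ≤ j → i + + ∣ j - i ∣ ≡ j
i≤j⇒i+∣j-i∣≡j {i} {j} i≤j = trans (cong (_+_ i) (0≤i⇒+∣i∣≡i (i≤j⇒0≤j-i i≤j))) (i+[j-i]≡j i j)
  where
  i+[j-i]≡j : ∀ i j → i + (j - i) ≡ j
  i+[j-i]≡j = solve-∀

periodic-at-multiple : ∀ {B : Set} {z : ℕ → B} {N g p} → IsPeriodic z N g p →
                       ∀ {k} → k ℕ.< N → g ∣ k → z k ≡ p 0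
periodic-at-multiple {g = suc l} {p} (_ , z≡p) {k} k<N g∣k =
  trans (z≡p k k<N) (cong p (n∣m⇒m%n≡0 k (suc l) g∣k))

periodic-window-aligned : ∀ {B : Set} (Y : ℤ → B) (I mn : ℤ) (m g : ℕ) {p : ℕ → B} →
  IsPeriodic (λ k → Y (I - + 2 * + m + + 1 + mn + + k)) (3 ℕ.* m) g p → g ∣ m →
  ∀ {c} → c ℕ.< m → g ∣ c → Y (I + + 1 + (mn + + c)) ≡ p 0
periodic-window-aligned Y I mn m g periodic g∣m {c} c<m g∣c = begin
  Y (I + + 1 + (mn + + c))                          ≡⟨ cong Y shift ⟩
  Y (I - + 2 * + m + + 1 + mn + + (2 ℕ.* m ℕ.+ c))  ≡⟨ periodic-at-multiple periodic 2m+c<3m (∣m∣n⇒∣m+n (∣n⇒∣m*n 2 g∣m) g∣c) ⟩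
  _                                                 ∎
  where
  open ≡-Reasoning
  2m+c<3m : 2 ℕ.* m ℕ.+ c ℕ.< 3 ℕ.* m
  2m+c<3m = subst (2 ℕ.* m ℕ.+ c ℕ.<_) (ℕ.+-comm (2 ℕ.* m) m) (ℕ.+-monoʳ-< (2 ℕ.* m) c<m)
  reassociate : ∀ I M mn C → I + + 1 + (mn + C) ≡ I - + 2 * M + + 1 + mn + (+ 2 * M + C)
  reassociate = solve-∀
  shift : I + + 1 + (mn + + c) ≡ I - + 2 * + m + + 1 + mn + + (2 ℕ.* m ℕ.+ c)
  shift = trans (reassociate I (+ m) mn (+ c))
    (cong (_+_ (I - + 2 * + m + + 1 + mn)) (sym (trans (pos-+ (2 ℕ.* m) c) (cong (_+ + c) (pos-* 2 m)))))

module _ {B : Set} (X Y : ℤ → B) (I : ℤ) (m : ℕ) where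

  NoMismatch : ℤ → Set
  NoMismatch d = ¬ (∃[ k ] (1 ℕ.≤ k × k ℕ.≤ m × X (I + + k) ≢ Y (I + + k + d)))

  module _ (v : B) (mn : ℤ) (g : ℕ)
           (y-aligned : ∀ {c} → c ℕ.< m → g ∣ c → Y (I + + 1 + (mn + + c)) ≡ v) where

    x-break⇒mismatch : ∀ {b} → b ℕ.< m → g ∣ b → X (I + + 1) ≢ v → ¬ NoMismatch (mn + + b)
    x-break⇒mismatch b<m g∣b x≢v no-mismatch =
      no-mismatch (1 , ℕ.≤-refl , ℕ.≤-trans (ℕ.s≤s ℕ.z≤n) b<m ,
                   λ x≡y → x≢v (trans x≡y (y-aligned b<m g∣b)))

    y-break⇒mismatch : ∀ {a b d' mx} → a ℕ.+ b ℕ.< m → g ∣ a → g ∣ b → d' + + a ≡ mx →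
                       Y (I + + 1 + mx) ≢ v → NoMismatch (mn + + b) → ¬ NoMismatch d'
    y-break⇒mismatch {a} {b} {d'} a+b<m g∣a g∣b refl y≢v no-mismatch no-mismatch' =
      no-mismatch' (suc a , 1≤1+a , 1+a≤m , λ x≡y' →
      no-mismatch  (suc a , 1≤1+a , 1+a≤m , λ x≡y → y≢v (begin
        Y (I + + 1 + (d' + + a))        ≡⟨ cong Y (mx-position I (+ a) d') ⟩
        Y (I + + suc a + d')            ≡⟨ sym x≡y' ⟩
        X (I + + suc a)                 ≡⟨ x≡y ⟩
        Y (I + + suc a + (mn + + b))    ≡⟨ cong Y (d-position I (+ a) (+ b) mn) ⟩
        Y (I + + 1 + (mn + + (a ℕ.+ b)))  ≡⟨ y-aligned a+b<m (∣m∣n⇒∣m+n g∣a g∣b) ⟩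
        v                               ∎)))
      where
      open ≡-Reasoning
      1≤1+a : 1 ℕ.≤ suc a
      1≤1+a = ℕ.s≤s ℕ.z≤n
      1+a≤m : suc a ℕ.≤ m
      1+a≤m = ℕ.≤-trans (ℕ.s≤s (ℕ.m≤m+n a b)) a+b<m
      mx-position : ∀ I A d' → I + + 1 + (d' + A) ≡ I + (+ 1 + A) + d'
      mx-position = solve-∀
      d-position : ∀ I A B mn → I + (+ 1 + A) + (mn + B) ≡ I + + 1 + (mn + (A + B))
      d-position = solve-∀

    break⇒mismatch : ∀ {a b d' mx} → a ℕ.+ b ℕ.< m → g ∣ a → g ∣ b → d' + + a ≡ mx →
                     X (I + + 1) ≢ v ⊎ Y (I + + 1 + mx) ≢ v →
                     NoMismatch (mn + + b) → ¬ NoMismatch d'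
    break⇒mismatch {a} {b} a+b<m g∣a g∣b d'+a≡mx (inj₁ x≢v) no-mismatch =
      ⊥-elim (x-break⇒mismatch (ℕ.≤-trans (ℕ.s≤s (ℕ.m≤n+m b a)) a+b<m) g∣b x≢v no-mismatch)
    break⇒mismatch a+b<m g∣a g∣b d'+a≡mx (inj₂ y≢v) =
      y-break⇒mismatch a+b<m g∣a g∣b d'+a≡mx y≢v

shift-offsets : ∀ D {d d'} → d ∈ D → d' ∈ D → d ℤ.< d' →
  ∃₂ λ a b → a ℕ.+ b ℕ.< ∣ maxL D - minL D ∣ × (gcdDiffs D ∣ a) × (gcdDiffs D ∣ b) ×
             d ≡ minL D + + b × d' + + a ≡ maxL D
shift-offsets D {d} {d'} d∈ d'∈ d<d' =
  a , b , drop‿+<+ a+b<m ,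
  gcdDiffs-∣ D (maxL-∈ D d∈) d'∈ d'≤mx , gcdDiffs-∣ D d∈ (minL-∈ D d∈) mn≤d ,
  sym (i≤j⇒i+∣j-i∣≡j mn≤d) , i≤j⇒i+∣j-i∣≡j d'≤mx
  where
  mn = minL D
  mx = maxL D
  a = ∣ mx - d' ∣
  b = ∣ d - mn ∣
  mn≤d : mn ≤ d
  mn≤d = minL-lower D d∈
  d'≤mx : d' ≤ mx
  d'≤mx = maxL-upper D d'∈
  +∣j-i∣≡j-i : ∀ {i j} → i ≤ j → + ∣ j - i ∣ ≡ j - i
  +∣j-i∣≡j-i i≤j = 0≤i⇒+∣i∣≡i (i≤j⇒0≤j-i i≤j)
  a+b<m : + (a ℕ.+ b) ℤ.< + ∣ mx - mn ∣
  a+b<m = begin-strict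
    + a + + b              ≡⟨ cong₂ _+_ (+∣j-i∣≡j-i d'≤mx) (+∣j-i∣≡j-i mn≤d) ⟩
    (mx - d') + (d - mn)   <⟨ +-monoʳ-< (mx - d') (+-monoˡ-< (- mn) d<d') ⟩
    (mx - d') + (d' - mn)  ≡⟨ +-minus-telescope mx d' mn ⟩
    mx - mn                ≡⟨ +∣j-i∣≡j-i (≤-trans mn≤d (≤-trans (<⇒≤ d<d') d'≤mx)) ⟨
    + ∣ mx - mn ∣          ∎
    where open ≤-Reasoning

lemma3p8 : {A : Set} (n : ℕ) (x y : Vec A n) (t : ℕ) (i : ℕ) (D : List ℤ) →
  1 ℕ.≤ t → 1 ℕ.≤ i → i ℕ.≤ n →
  Unique D → All (λ d → (- (+ t)) ≤ d × d ≤ + t) D → 1 ℕ.< length D →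
  let g = gcdDiffs D
      m = ∣ maxL D - minL D ∣
      I = + i
      p = λ (r : ℕ) → at x (I - + g + + 1 + + r)
  in
  -- all indices used lie in [1..n]
  + 1 ≤ I - + 2 * + m + + 1 →
  + 1 ≤ I - + 2 * + m + + 1 + minL D →
  I + + m ≤ + n →
  I + + m + maxL D ≤ + n →
  I + + 1 + maxL D ≤ + n →
  -- x_[i-2m+1..i] periodic with pattern p (length 2m, period g)
  IsPeriodic (λ k → at x (I - + 2 * + m + + 1 + + k)) (2 ℕ.* m) g p →
  -- y_[i-2m+1+minD..i+maxD] periodic with pattern p (length 3m, period g)
  IsPeriodic (λ k → at y (I - + 2 * + m + + 1 + minL D + + k)) (3 ℕ.* m) g p →
  (at x (I + + 1) ≢ p 0 ⊎ at y (I + + 1 + maxL D) ≢ p 0) →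
  -- at most one d ∈ D fails to have a mismatch x_j ≠ y_{j+d}, j ∈ [i+1..i+m]
  ∀ d d' → d ∈ D → d' ∈ D →
  ¬ (∃[ k ] (1 ℕ.≤ k × k ℕ.≤ m × at x (I + + k) ≢ at y (I + + k + d))) →
  ¬ (∃[ k ] (1 ℕ.≤ k × k ℕ.≤ m × at x (I + + k) ≢ at y (I + + k + d'))) →
  d ≡ d'
lemma3p8 n x y t i D _ _ _ _ _ _ _ _ _ _ _ _ y-periodic break d d' d∈ d'∈ =
  at-most-one-shift d∈ d'∈
  where
  m = ∣ maxL D - minL D ∣
  Agrees : ℤ → Set
  Agrees = NoMismatch (at x) (at y) (+ i) m
  g∣m : gcdDiffs D ∣ m
  g∣m = gcdDiffs-∣ D (maxL-∈ D d∈) (minL-∈ D d∈) (≤-trans (minL-lower D d∈) (maxL-upper D d∈))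
  ordered : ∀ {e e'} → e ∈ D → e' ∈ D → e ℤ.< e' → Agrees e → ¬ Agrees e'
  ordered {e' = e'} e∈ e'∈ e<e' with shift-offsets D e∈ e'∈ e<e'
  ... | a , b , a+b<m , g∣a , g∣b , refl , e'+a≡mx =
    break⇒mismatch (at x) (at y) (+ i) m _ (minL D) (gcdDiffs D)
      (periodic-window-aligned (at y) (+ i) (minL D) m (gcdDiffs D) y-periodic g∣m) {d' = e'}
      a+b<m g∣a g∣b e'+a≡mx break
  at-most-one-shift : ∀ {e e'} → e ∈ D → e' ∈ D → Agrees e → Agrees e' → e ≡ e'
  at-most-one-shift {e} {e'} e∈ e'∈ agrees agrees' with <-cmp e e'
  ... | tri< e<e' _ _ = ⊥-elim (ordered e∈ e'∈ e<e' agrees agrees')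
  ... | tri≈ _ e≡e' _ = e≡e'
  ... | tri> _ _ e'<e = ⊥-elim (ordered e'∈ e∈ e'<e agrees' agrees)
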